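{- Let $G_1,G_2$ be graphs on the node set $\{1,\dots,n\}$ and let $i_1$ be a node of $G_1$ and $i_2$ a node of $G_2$. Then $\mathfrak{w}_{G_1}(i_1)\simeq\mathfrak{w}_{G_2}(i_2)$ if and only if $\mathfrak{w}_{G_1}(i_1)|_{n+1}\simeq\mathfrak{w}_{G_2}(i_2)|_{n+1}$, where $Q|_{m}$ denotes the submatrix formed by the first $m$ columns (those indexed by $l=0,1,\dots,m-1$).
   Context: Graphs are finite undirected graphs without multiple edges, with at least two nodes; loops are permitted (a loop at $i$ gives adjacency entry $A_{ii}=1$). For a graph $G$ with adjacency matrix $A$ and a node $i$, the $\mathfrak{w}$-label $\mathfrak{w}_G(i)$ is the matrix with rows indexed by the nodes $j$ and columns indexed by $l\in\{0,1,2,\dots\}$ whose $(j,l)$ entry is $(A^l)_{ij}$, the number of walks of length $l$ between $i$ and $j$. Two matrices $Q_1,Q_2$ with the same row index set are permutation-equal, written $Q_1\simeq Q_2$, if there is a permutation matrix $P$ with $PQ_1=Q_2$. -}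

module Defs where

open import Data.Nat using (ℕ; zero; suc; _+_; _*_; _<_)
open import Data.Bool using (Bool; true; false)
open import Data.Fin using (Fin)
open import Data.List using (map; allFin)
open import Data.Nat.ListAction using (sum)
open import Data.Product using (Σ; _×_)
open import Function.Bundles using (_↔_; Inverse)
open import Relation.Binary.PropositionalEquality using (_≡_)
import Data.Fin
import Relation.Nullary

-- A graph on node set Fin n: a symmetric Boolean adjacency relation.
-- Loops allowed (A i i may be true); no multiple edges.
record Graph (n : ℕ) : Set where
  field
    adj : Fin n → Fin n → Bool
    sym : ∀ i j → adj i j ≡ adj j i

open Graph public

A : ∀ {n} → Graph n → Fin n → Fin n → ℕ
A G i j with adj G i j
... | true  = 1
... | false = 0

walks : ∀ {n} → Graph n → ℕ → Fin n → Fin n → ℕ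
walks G zero    i j with Data.Fin._≟_ i j
... | Relation.Nullary.yes _ = 1
... | Relation.Nullary.no  _ = 0
walks {n} G (suc l) i j = sum (map (λ k → walks G l i k * A G k j) (allFin n))

Mat : ℕ → Set
Mat n = Fin n → ℕ → ℕ

wlabel : ∀ {n} → Graph n → Fin n → Mat n
wlabel G i j l = walks G l i j

-- permutation-equality: P Q₁ = Q₂ for a permutation matrix P,
-- i.e. a bijection σ of the rows with Q₁ (σ j) ≡ Q₂ j for all rows j, columns l
_≃P_ : ∀ {n} → Mat n → Mat n → Set
_≃P_ {n} Q₁ Q₂ = Σ (Fin n ↔ Fin n) λ σ → ∀ j l → Q₁ (Inverse.to σ j) l ≡ Q₂ j l

_≃P[_]_ : ∀ {n} → Mat n → ℕ → Mat n → Set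
_≃P[_]_ {n} Q₁ m Q₂ = Σ (Fin n ↔ Fin n) λ σ → ∀ j l → l < m → Q₁ (Inverse.to σ j) l ≡ Q₂ j l

-- The columns w₀, …, wₙ of the label of i, w_l = (A^l)_{i,·}, are n + 1 vectors in ℤⁿ,
-- so they are linearly dependent; keeping the last nonzero coefficient gives a relation
-- e₀ w₀ + ⋯ + e_d w_d = 0 with e_d ≠ 0 and d ≤ n.  Multiplying by A^m shifts it to every
-- window w_m, …, w_{m+d}, so each row of the label, read as a sequence in l, satisfies a
-- linear recurrence of order d.  A permutation matching the first n + 1 columns carries the
-- relation over to the second graph, and two sequences satisfying the same recurrence and
-- agreeing on their first d terms are equal.
module Submission where

open import Defs hiding (sym)
open import Data.Nat as ℕ using (ℕ; zero; suc; _≤_; _<_; _∸_; z≤n; s≤s; s≤s⁻¹)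
open import Data.Nat.Properties
  using (≤-refl; ≤-trans; m≤n⇒m≤1+n; ≤∧≢⇒<; ≮⇒≥; m∸n+n≡m; +-monoʳ-<; _<?_)
open import Data.Nat.Induction using (<-rec)
open import Data.Fin using (Fin; zero; suc; toℕ; punchIn)
open import Data.Fin.Properties using (all?; ¬∀⟶∃¬; toℕ<n; toℕ-inject₁; toℕ-fromℕ)
open import Data.Integer using (ℤ; +_; 0ℤ; 1ℤ; -_; _+_; _*_; ≢-nonZero)
open import Data.Integer.Properties as ℤ using (+-*-semiring; +-0-abelianGroup)
open import Data.Integer.Tactic.RingSolver using (solve-∀)
import Data.List as List
import Data.List.Properties as List
import Data.Nat.ListAction as ℕ
open import Data.Product using (∃; ∃₂; _×_; _,_)
open import Data.Sum using (inj₁; inj₂)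
open import Data.Vec.Functional using (_∷_; insertAt)
open import Data.Vec.Functional.Properties using (insertAt-lookup; insertAt-punchIn)
open import Function using (_∘_)
open import Function.Bundles using (_⇔_; Inverse; mk⇔)
open import Relation.Binary.PropositionalEquality
open import Relation.Nullary using (yes; no)
open import Relation.Nullary.Negation using (contradiction)

open import Algebra.Properties.Semiring.Sum +-*-semiring
  using (sum; sum-syntax; sum-remove; sum-init-last; ∑-distrib-+; ∑-comm;
         *-distribˡ-sum; *-distribʳ-sum; sum-cong-≗; sum-replicate-zero)
open import Algebra.Properties.AbelianGroup +-0-abelianGroup using (∙-cancelˡ)

sum-zero : ∀ {m} {f : Fin m → ℤ} → (∀ k → f k ≡ 0ℤ) → sum f ≡ 0ℤ
sum-zero {m} f≡0 = trans (sum-cong-≗ f≡0) (sum-replicate-zero m)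

sum-insertAt : ∀ {m} (c : Fin m → ℤ) (p : Fin (suc m)) (x : ℤ) (u : Fin (suc m) → ℤ) →
  ∑[ i < suc m ] (insertAt c p x i * u i) ≡ x * u p + ∑[ k < m ] (c k * u (punchIn p k))
sum-insertAt c p x u = trans (sum-remove {i = p} (λ i → insertAt c p x i * u i))
  (cong₂ (λ y z → y * u p + z) (insertAt-lookup c p x)
    (sum-cong-≗ λ k → cong (_* u (punchIn p k)) (insertAt-punchIn c p x k)))

Nontrivial : ∀ {m} → (Fin m → ℤ) → Set
Nontrivial c = ∃ λ k → c k ≢ 0ℤ

IsRelation : ∀ {m n} → (Fin m → Fin n → ℤ) → (Fin m → ℤ) → Set
IsRelation {m} v c = ∀ j → ∑[ k < m ] (c k * v k j) ≡ 0ℤ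

Dependent : ∀ {m n} → (Fin m → Fin n → ℤ) → Set
Dependent v = ∃ λ c → Nontrivial c × IsRelation v c

dependent-zeroColumn : ∀ {m n} (v : Fin (suc m) → Fin (suc n) → ℤ) →
  (∀ k → v k zero ≡ 0ℤ) → Dependent (λ k j → v (suc k) (suc j)) → Dependent v
dependent-zeroColumn v column≡0 (c , (k , ck≢0) , rel) =
  0ℤ ∷ c , (suc k , ck≢0) , λ where
    zero    → sum-zero λ k → trans (cong ((0ℤ ∷ c) k *_) (column≡0 k)) (ℤ.*-zeroʳ ((0ℤ ∷ c) k))
    (suc j) → trans (ℤ.+-identityˡ _) (rel j)

-- Gaussian elimination of the first coordinate, using the pivot vector v p.
module Pivot {m n} (v : Fin (suc m) → Fin (suc n) → ℤ) (p : Fin (suc m)) where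

  a : ℤ
  a = v p zero

  eliminated : Fin m → Fin (suc n) → ℤ
  eliminated k y = a * v (punchIn p k) y + (- v (punchIn p k) zero) * v p y

  eliminated-zero : ∀ k → eliminated k zero ≡ 0ℤ
  eliminated-zero k = cancel a (v (punchIn p k) zero)
    where
    cancel : ∀ a b → a * b + (- b) * a ≡ 0ℤ
    cancel = solve-∀

  lift : (Fin m → ℤ) → Fin (suc m) → ℤ
  lift c = insertAt (λ k → a * c k) p (∑[ k < m ] (c k * - v (punchIn p k) zero))

  lift-combination : ∀ c y →
    ∑[ i < suc m ] (lift c i * v i y) ≡ ∑[ k < m ] (c k * eliminated k y)
  lift-combination c y = begin
    ∑[ i < suc m ] (lift c i * v i y)
      ≡⟨ sum-insertAt (λ k → a * c k) p _ (λ i → v i y) ⟩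
    (∑[ k < m ] (c k * - b k)) * v p y + ∑[ k < m ] (a * c k * v (punchIn p k) y)
      ≡⟨ cong (_+ rest) (*-distribʳ-sum (v p y) (λ k → c k * - b k)) ⟩
    ∑[ k < m ] (c k * - b k * v p y) + ∑[ k < m ] (a * c k * v (punchIn p k) y)
      ≡⟨ sym (∑-distrib-+ (λ k → c k * - b k * v p y) (λ k → a * c k * v (punchIn p k) y)) ⟩
    ∑[ k < m ] (c k * - b k * v p y + a * c k * v (punchIn p k) y)
      ≡⟨ sum-cong-≗ (λ k → distribute (c k) a (b k) (v p y) (v (punchIn p k) y)) ⟩
    ∑[ k < m ] (c k * eliminated k y) ∎
    where
    open ≡-Reasoning
    b : Fin m → ℤ
    b k = v (punchIn p k) zero
    rest : ℤ
    rest = ∑[ k < m ] (a * c k * v (punchIn p k) y)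
    distribute : ∀ c a b x y → c * - b * x + a * c * y ≡ c * (a * y + (- b) * x)
    distribute = solve-∀

  dependent-lift : a ≢ 0ℤ → Dependent (λ k j → eliminated k (suc j)) → Dependent v
  dependent-lift a≢0 (c , (k , ck≢0) , rel) = lift c , (punchIn p k , lift-nonzero) , lift-rel
    where
    lift-nonzero : lift c (punchIn p k) ≢ 0ℤ
    lift-nonzero eq with ℤ.i*j≡0⇒i≡0∨j≡0 a (trans (sym (insertAt-punchIn _ p _ k)) eq)
    ... | inj₁ a≡0  = a≢0 a≡0
    ... | inj₂ ck≡0 = ck≢0 ck≡0
    lift-rel : IsRelation v (lift c)
    lift-rel zero    = trans (lift-combination c zero)
                             (sum-zero λ k → trans (cong (c k *_) (eliminated-zero k)) (ℤ.*-zeroʳ (c k)))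
    lift-rel (suc j) = trans (lift-combination c (suc j)) (rel j)

dependent : ∀ n (v : Fin (suc n) → Fin n → ℤ) → Dependent v
dependent zero    v = (λ _ → 1ℤ) , (zero , λ ()) , λ ()
dependent (suc n) v with all? (λ k → v k zero ℤ.≟ 0ℤ)
... | yes column≡0 = dependent-zeroColumn v column≡0 (dependent n λ k j → v (suc k) (suc j))
... | no ¬column≡0 with ¬∀⟶∃¬ _ _ (λ k → v k zero ℤ.≟ 0ℤ) ¬column≡0
...   | p , vp≢0 = Pivot.dependent-lift v p vp≢0 (dependent n λ k j → Pivot.eliminated v p k (suc j))

sumBelow : ℕ → (ℕ → ℤ) → ℤ
sumBelow r f = ∑[ k < r ] f (toℕ k)

sumBelow-suc : ∀ r f → sumBelow (suc r) f ≡ sumBelow r f + f r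
sumBelow-suc r f = trans (sum-init-last {r} (f ∘ toℕ))
  (cong₂ _+_ (sum-cong-≗ {r} λ k → cong f (toℕ-inject₁ k)) (cong f (toℕ-fromℕ r)))

sumBelow-cong : ∀ {r f g} → (∀ k → k < r → f k ≡ g k) → sumBelow r f ≡ sumBelow r g
sumBelow-cong f≡g = sum-cong-≗ λ k → f≡g (toℕ k) (toℕ<n k)

Recurrence : (ℕ → ℤ) → ℕ → (ℕ → ℤ) → Set
Recurrence e r s = ∀ m → sumBelow r (λ k → e k * s (m ℕ.+ k)) ≡ 0ℤ

-- With e d ≠ 0, the recurrence determines s (m + d) from s m, …, s (m + d ∸ 1).
recurrence-unique : ∀ e d → e d ≢ 0ℤ → ∀ {s t} → Recurrence e (suc d) s → Recurrence e (suc d) t →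
  (∀ l → l < d → s l ≡ t l) → ∀ l → s l ≡ t l
recurrence-unique e d ed≢0 {s} {t} recˢ recᵗ s≡t<d = <-rec _ step
  where
  step : ∀ l → (∀ {l′} → l′ < l → s l′ ≡ t l′) → s l ≡ t l
  step l ih with l <? d
  ... | yes l<d = s≡t<d l l<d
  ... | no l≮d = subst (λ z → s z ≡ t z) m+d≡l
          (ℤ.*-cancelˡ-≡ (e d) _ _ {{≢-nonZero ed≢0}} (∙-cancelˡ (window s) _ _ windows))
    where
    m = l ∸ d
    m+d≡l : m ℕ.+ d ≡ l
    m+d≡l = m∸n+n≡m (≮⇒≥ l≮d)
    term : (ℕ → ℤ) → ℕ → ℤ
    term f k = e k * f (m ℕ.+ k)
    window : (ℕ → ℤ) → ℤ
    window f = sumBelow d (term f)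
    earlier : window s ≡ window t
    earlier = sumBelow-cong λ k k<d →
      cong (e k *_) (ih (subst (m ℕ.+ k <_) m+d≡l (+-monoʳ-< m k<d)))
    windows : window s + e d * s (m ℕ.+ d) ≡ window s + e d * t (m ℕ.+ d)
    windows = begin
      window s + term s d        ≡⟨ sumBelow-suc d (term s) ⟨
      sumBelow (suc d) (term s)  ≡⟨ trans (recˢ m) (sym (recᵗ m)) ⟩
      sumBelow (suc d) (term t)  ≡⟨ sumBelow-suc d (term t) ⟩
      window t + term t d        ≡⟨ cong (_+ term t d) earlier ⟨
      window s + term t d        ∎
      where open ≡-Reasoning

Annihilates : ∀ {n} → (ℕ → ℤ) → ℕ → (ℕ → Fin n → ℤ) → Set
Annihilates e r w = ∀ y → sumBelow r (λ k → e k * w k y) ≡ 0ℤ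

extendByZero : ∀ {m} → (Fin m → ℤ) → ℕ → ℤ
extendByZero {zero}  c l       = 0ℤ
extendByZero {suc m} c zero    = c zero
extendByZero {suc m} c (suc l) = extendByZero (c ∘ suc) l

extendByZero-toℕ : ∀ {m} (c : Fin m → ℤ) k → extendByZero c (toℕ k) ≡ c k
extendByZero-toℕ c zero    = refl
extendByZero-toℕ c (suc k) = extendByZero-toℕ (c ∘ suc) k

annihilates-drop-last : ∀ {n} e r (w : ℕ → Fin n → ℤ) → e r ≡ 0ℤ →
  Annihilates e (suc r) w → Annihilates e r w
annihilates-drop-last e r w er≡0 ann y = begin
  sumBelow r f                 ≡⟨ ℤ.+-identityʳ _ ⟨
  sumBelow r f + 0ℤ            ≡⟨ cong (_+_ (sumBelow r f)) last≡0 ⟨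
  sumBelow r f + e r * w r y   ≡⟨ sumBelow-suc r f ⟨
  sumBelow (suc r) f           ≡⟨ ann y ⟩
  0ℤ                           ∎
  where
  open ≡-Reasoning
  f : ℕ → ℤ
  f k = e k * w k y
  last≡0 : e r * w r y ≡ 0ℤ
  last≡0 = trans (cong (_* w r y) er≡0) (ℤ.*-zeroˡ (w r y))

trimAnnihilator : ∀ {n} N e (w : ℕ → Fin n → ℤ) {k} → k ≤ N → e k ≢ 0ℤ → Annihilates e (suc N) w →
  ∃ λ d → d ≤ N × e d ≢ 0ℤ × Annihilates e (suc d) w
trimAnnihilator N e w k≤N ek≢0 ann with e N ℤ.≟ 0ℤ
... | no eN≢0 = N , ≤-refl , eN≢0 , ann
trimAnnihilator zero e w z≤n ek≢0 ann | yes eN≡0 = contradiction eN≡0 ek≢0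
trimAnnihilator (suc N) e w {k} k≤1+N ek≢0 ann | yes eN≡0
  with trimAnnihilator N e w k≤N ek≢0 (annihilates-drop-last e (suc N) w eN≡0 ann)
  where
  k≤N : k ≤ N
  k≤N = s≤s⁻¹ (≤∧≢⇒< k≤1+N λ { refl → ek≢0 eN≡0 })
... | d , d≤N , ed≢0 , annᵈ = d , m≤n⇒m≤1+n d≤N , ed≢0 , annᵈ

leadingAnnihilator : ∀ n (w : ℕ → Fin n → ℤ) → ∃₂ λ e d → d ≤ n × e d ≢ 0ℤ × Annihilates e (suc d) w
leadingAnnihilator n w with dependent n (λ k → w (toℕ k))
... | c , (k , ck≢0) , rel = extendByZero c , trimAnnihilator n (extendByZero c) w
        (s≤s⁻¹ (toℕ<n k)) (ck≢0 ∘ trans (sym (extendByZero-toℕ c k))) ann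
  where
  ann : Annihilates (extendByZero c) (suc n) w
  ann y = trans (sum-cong-≗ λ k → cong (_* w (toℕ k) y) (extendByZero-toℕ c k)) (rel y)

recurrence-shift : ∀ {n} (M : Fin n → Fin n → ℤ) (w : ℕ → Fin n → ℤ) →
  (∀ l y → w (suc l) y ≡ ∑[ x < n ] (w l x * M x y)) →
  ∀ e r → Annihilates e r w → ∀ y → Recurrence e r (λ l → w l y)
recurrence-shift M w orbit e r ann y zero = ann y
recurrence-shift {n} M w orbit e r ann y (suc m) = begin
  sumBelow r (λ k → e k * w (suc m ℕ.+ k) y)
    ≡⟨ sum-cong-≗ {r} (λ k → cong (e (toℕ k) *_) (orbit (m ℕ.+ toℕ k) y)) ⟩
  ∑[ k < r ] (e (toℕ k) * ∑[ x < n ] (u k x * M x y))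
    ≡⟨ sum-cong-≗ {r} (λ k → *-distribˡ-sum {n} (e (toℕ k)) (λ x → u k x * M x y)) ⟩
  ∑[ k < r ] ∑[ x < n ] (e (toℕ k) * (u k x * M x y))
    ≡⟨ ∑-comm {r} {n} (λ k x → e (toℕ k) * (u k x * M x y)) ⟩
  ∑[ x < n ] ∑[ k < r ] (e (toℕ k) * (u k x * M x y))
    ≡⟨ sum-cong-≗ {n} (λ x → sum-cong-≗ {r} λ k → sym (ℤ.*-assoc (e (toℕ k)) (u k x) (M x y))) ⟩
  ∑[ x < n ] ∑[ k < r ] (e (toℕ k) * u k x * M x y)
    ≡⟨ sum-cong-≗ {n} (λ x → sym (*-distribʳ-sum {r} (M x y) (λ k → e (toℕ k) * u k x))) ⟩
  ∑[ x < n ] (sumBelow r (λ k → e k * w (m ℕ.+ k) x) * M x y)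
    ≡⟨ sum-zero {n} (λ x → cong (_* M x y) (recurrence-shift M w orbit e r ann x m)) ⟩
  0ℤ ∎
  where
  open ≡-Reasoning
  u : Fin r → Fin n → ℤ
  u k = w (m ℕ.+ toℕ k)

+-sum-tabulate : ∀ {n} (f : Fin n → ℕ) → + ℕ.sum (List.tabulate f) ≡ ∑[ k < n ] (+ f k)
+-sum-tabulate {zero}  f = refl
+-sum-tabulate {suc n} f = trans (ℤ.pos-+ (f zero) _) (cong (_+_ (+ f zero)) (+-sum-tabulate (f ∘ suc)))

walksℤ : ∀ {n} → Graph n → Fin n → ℕ → Fin n → ℤ
walksℤ G i l j = + walks G l i j

walksℤ-suc : ∀ {n} (G : Graph n) i l j →
  walksℤ G i (suc l) j ≡ ∑[ x < n ] (walksℤ G i l x * + A G x j)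
walksℤ-suc {n} G i l j = begin
  + ℕ.sum (List.map f (List.allFin n)) ≡⟨ cong (+_ ∘ ℕ.sum) (List.map-tabulate (λ x → x) f) ⟩
  + ℕ.sum (List.tabulate f)            ≡⟨ +-sum-tabulate f ⟩
  ∑[ x < n ] (+ f x)                   ≡⟨ sum-cong-≗ (λ x → ℤ.pos-* (walks G l i x) (A G x j)) ⟩
  ∑[ x < n ] (walksℤ G i l x * + A G x j) ∎
  where
  open ≡-Reasoning
  f : Fin n → ℕ
  f k = walks G l i k ℕ.* A G k j

wlabel-prefix⇒≃P : ∀ {n} (G₁ G₂ : Graph n) i₁ i₂ →
  wlabel G₁ i₁ ≃P[ suc n ] wlabel G₂ i₂ → wlabel G₁ i₁ ≃P wlabel G₂ i₂
wlabel-prefix⇒≃P {n} G₁ G₂ i₁ i₂ (σ , agree) with leadingAnnihilator n (walksℤ G₁ i₁)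
... | e , d , d≤n , ed≢0 , ann₁ = σ , λ j l → ℤ.+-injective (rows-equal j l)
  where
  to : Fin n → Fin n
  to = Inverse.to σ
  below : ∀ {l} → l < suc d → l < suc n
  below l<1+d = s≤s (≤-trans (s≤s⁻¹ l<1+d) d≤n)
  ann₂ : Annihilates e (suc d) (walksℤ G₂ i₂)
  ann₂ j = trans (sumBelow-cong λ k k<1+d → cong (λ z → e k * + z) (sym (agree j k (below k<1+d))))
                 (ann₁ (to j))
  rec₁ : ∀ y → Recurrence e (suc d) (λ l → walksℤ G₁ i₁ l y)
  rec₁ = recurrence-shift (λ x y → + A G₁ x y) (walksℤ G₁ i₁) (walksℤ-suc G₁ i₁) e (suc d) ann₁
  rec₂ : ∀ y → Recurrence e (suc d) (λ l → walksℤ G₂ i₂ l y)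
  rec₂ = recurrence-shift (λ x y → + A G₂ x y) (walksℤ G₂ i₂) (walksℤ-suc G₂ i₂) e (suc d) ann₂
  rows-equal : ∀ j l → walksℤ G₁ i₁ l (to j) ≡ walksℤ G₂ i₂ l j
  rows-equal j = recurrence-unique e d ed≢0 (rec₁ (to j)) (rec₂ j)
    λ l l<d → cong +_ (agree j l (below (m≤n⇒m≤1+n l<d)))

theorem1 : (n : ℕ) → 2 ≤ n → (G₁ G₂ : Graph n) (i₁ i₂ : Fin n) →
    (wlabel G₁ i₁ ≃P wlabel G₂ i₂) ⇔ (wlabel G₁ i₁ ≃P[ suc n ] wlabel G₂ i₂)
theorem1 n _ G₁ G₂ i₁ i₂ =
  mk⇔ (λ (σ , agree) → σ , λ j l _ → agree j l) (wlabel-prefix⇒≃P G₁ G₂ i₁ i₂)
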